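{- Let $k\ge1$ and let $T\subseteq 2^{<\omega}$ be a nonempty tree without leaves. Every $k$-tree-split $f$ on $T$ admits a refinement, i.e. there is a refined $k$-tree-split $\tilde f$ on $T$ with $\tilde f(\rho)\subseteq f(\rho)$ for all $\rho\in T$.
   Context: A tree is any subset $T\subseteq 2^{<\omega}$ (not necessarily closed under initial segments), ordered by $\preceq$ (initial segment); it has no leaves if every node has a proper extension in $T$. For $\rho\in T$, $|\rho|_T$ is the number of $\sigma\in T$ with $\sigma\preceq\rho$; an immediate successor of $\rho$ in $T$ is $\rho^+\in T$, $\rho\prec\rho^+$, with no element of $T$ strictly between. For $\zeta\in k^n$ and $m\le n$, $\zeta{\upharpoonright}m$ is the first $m$ entries, and $A{\upharpoonright}m=\{\zeta{\upharpoonright}m:\zeta\in A\}$. A $k$-tree-split on $T$ is a function $f$ from $T$ to finite subsets of $k^{<\omega}$ such that for each $\rho\in T$, $f(\rho)$ is a nonempty subset of $k^{|\rho|_T}$ and $f(\rho)=\bigcup\{f(\rho^+){\upharpoonright}|\rho|_T:\rho^+\text{ an immediate successor of }\rho\text{ in }T\}$. A $k$-tree-split $f$ on $T$ is refined if for every $\rho\in T$ and every $\zeta\in f(\rho)$ there is $\rho'\in T$ with $\rho'\succeq\rho$ such that $\zeta\in f(\rho''){\upharpoonright}|\rho|_T$ for all $\rho''\in T$ with $\rho''\succeq\rho'$. -}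

module Defs where

open import Level using (0ℓ)
open import Data.Bool using (Bool; true)
open import Data.Nat using (ℕ)
open import Data.Fin using (Fin)
open import Data.List using (List; _++_; length; inits; filterᵇ; take)
open import Data.Product using (_×_; ∃-syntax)
open import Data.Empty using (⊥)
open import Relation.Binary.PropositionalEquality using (_≡_; _≢_)
open import Function.Bundles using (_⇔_)

Str : Set
Str = List Bool

_⪯_ : Str → Str → Set
σ ⪯ ρ = ∃[ τ ] (σ ++ τ ≡ ρ)

_≺_ : Str → Str → Set
σ ≺ ρ = (σ ⪯ ρ) × (σ ≢ ρ)

-- a tree = an arbitrary subset of 2^{<ω}, given by its characteristic function
Tree : Set
Tree = Str → Bool

_∈T_ : Str → Tree → Set
ρ ∈T T = T ρ ≡ true

NonemptyTree : Tree → Set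
NonemptyTree T = ∃[ ρ ] (ρ ∈T T)

NoLeaves : Tree → Set
NoLeaves T = ∀ ρ → ρ ∈T T → ∃[ ρ' ] ((ρ' ∈T T) × (ρ ≺ ρ'))

-- |ρ|_T : number of σ ∈ T with σ ⪯ ρ  (inits ρ lists exactly the σ ⪯ ρ)
depth : Tree → Str → ℕ
depth T ρ = length (filterᵇ T (inits ρ))

ImmSucc : Tree → Str → Str → Set
ImmSucc T ρ ρ⁺ =
  (ρ⁺ ∈T T) × (ρ ≺ ρ⁺) × (∀ σ → σ ∈T T → ρ ≺ σ → σ ≺ ρ⁺ → ⊥)

SubsetK : ℕ → Set₁
SubsetK k = List (Fin k) → Set

Restrict : {k : ℕ} → ℕ → SubsetK k → SubsetK k
Restrict m A ζ = ∃[ η ] (A η × (take m η ≡ ζ))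

-- f is a k-tree-split on T (values of f outside T are irrelevant).
-- f(ρ) ⊆ k^{|ρ|_T} (hence finite), f(ρ) nonempty, and
-- f(ρ) = ⋃ { f(ρ⁺)↾|ρ|_T : ρ⁺ immediate successor of ρ in T }.
IsTreeSplit : (k : ℕ) → Tree → (Str → SubsetK k) → Set
IsTreeSplit k T f = ∀ ρ → ρ ∈T T →
    (∀ ζ → f ρ ζ → length ζ ≡ depth T ρ)
  × (∃[ ζ ] f ρ ζ)
  × (∀ ζ → f ρ ζ ⇔ (∃[ ρ⁺ ] (ImmSucc T ρ ρ⁺ × Restrict (depth T ρ) (f ρ⁺) ζ)))

Refined : (k : ℕ) → Tree → (Str → SubsetK k) → Set
Refined k T f = ∀ ρ → ρ ∈T T → ∀ ζ → f ρ ζ →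
  ∃[ ρ' ] ((ρ' ∈T T) × (ρ ⪯ ρ') ×
    (∀ ρ'' → ρ'' ∈T T → ρ' ⪯ ρ'' → Restrict (depth T ρ) (f ρ'') ζ))

-- Refine f by keeping in f̃(ρ) exactly the ζ ∈ k^{|ρ|_T} that persist above ρ: from some
-- ρ' ⪰ ρ on, ζ ∈ f(ρ'')↾|ρ|_T for every ρ'' ⪰ ρ'.  The split condition lets membership
-- descend along the tree, and absence is upward closed.  Since only finitely many ζ are
-- candidates, if none of those with a given property persisted, they could all be made
-- absent at a single node; so whenever every node above some ρ₀ ⪰ ρ carries a candidate
-- with the property, some candidate with it persists.  Applied to the candidates
-- extending a given persistent ζ, this yields both the split condition and refinedness.
module Submission where

open import Defs
open import Level using (0ℓ)
open import Axiom.ExcludedMiddle using (ExcludedMiddle)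
open import Data.Nat using (ℕ; _≤_)
open import Data.Product using (_×_; ∃-syntax)

open import Axiom.DoubleNegationElimination using (DoubleNegationElimination; em⇒dne)
open import Data.Bool using (Bool; true; false; _≟_)
open import Data.Nat using (zero; suc; _+_; _∸_; _<_; s≤s; z<s)
open import Data.Nat.Induction using (<-wellFounded)
open import Data.Nat.Properties
  using (≤-refl; ≤-reflexive; m≤m+n; m<m+n; +-monoʳ-≤; m⊓n≤m; m≤n⇒m⊓n≡m; ∸-monoʳ-<)
open import Data.List using (List; []; _∷_; [_]; _++_; map; length; take; inits; filterᵇ; allFin; cartesianProductWith)
open import Data.List.Properties using (++-identityʳ; ++-assoc; length-++; length-take; take-take; take-all; ≡-dec)
open import Data.List.Membership.Propositional using (_∈_)
open import Data.List.Membership.Propositional.Properties using (∈-allFin; ∈-cartesianProductWith⁺)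
open import Data.List.Relation.Unary.All as All using (All; []; _∷_)
open import Data.List.Relation.Unary.Any using (here; there)
open import Data.Fin using (Fin)
open import Data.Product using (_,_; proj₁; proj₂)
open import Data.Unit using (⊤; tt)
open import Data.Empty using (⊥-elim)
open import Function using (_∘_)
open import Function.Bundles using (Equivalence; mk⇔)
open import Induction.WellFounded using (Acc; acc)
open import Relation.Nullary using (¬_; yes; no)
open import Relation.Binary.PropositionalEquality using (_≡_; refl; sym; trans; cong; subst; subst₂)

private
  variable
    k m n : ℕ
    σ σ' ρ ρ' ρ⁺ τ : Str
    ζ η θ : List (Fin k)

⪯-refl : σ ⪯ σ
⪯-refl {σ} = [] , ++-identityʳ σ

⪯-trans : σ ⪯ ρ → ρ ⪯ τ → σ ⪯ τ
⪯-trans {σ} (u , refl) (v , refl) = u ++ v , sym (++-assoc σ u v)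

⪯⇒length≤ : σ ⪯ ρ → length σ ≤ length ρ
⪯⇒length≤ {σ} (u , refl) = subst (length σ ≤_) (sym (length-++ σ)) (m≤m+n _ _)

≺⇒length< : σ ≺ ρ → length σ < length ρ
≺⇒length< {σ} (([] , σ++[]≡ρ) , σ≢ρ) = ⊥-elim (σ≢ρ (trans (sym (++-identityʳ σ)) σ++[]≡ρ))
≺⇒length< {σ} ((_ ∷ _ , refl) , _) = subst (length σ <_) (sym (length-++ σ)) (m<m+n _ z<s)

length-filterᵇ-map : ∀ {A B : Set} (p : B → Bool) (g : A → B) xs →
  length (filterᵇ p (map g xs)) ≡ length (filterᵇ (p ∘ g) xs)
length-filterᵇ-map p g [] = refl
length-filterᵇ-map p g (x ∷ xs) with p (g x)
... | true = cong suc (length-filterᵇ-map p g xs)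
... | false = length-filterᵇ-map p g xs

depth-∷ : ∀ T x ρ → depth T (x ∷ ρ) ≡ depth T [] + depth (T ∘ (x ∷_)) ρ
depth-∷ T x ρ with T []
... | true = cong suc (length-filterᵇ-map T (x ∷_) (inits ρ))
... | false = length-filterᵇ-map T (x ∷_) (inits ρ)

depth-++ : ∀ T σ u → depth T σ ≤ depth T (σ ++ u)
depth-++ T [] [] = ≤-refl
depth-++ T [] (x ∷ u) = subst (depth T [] ≤_) (sym (depth-∷ T x u)) (m≤m+n _ _)
depth-++ T (x ∷ σ) u = subst₂ _≤_ (sym (depth-∷ T x σ)) (sym (depth-∷ T x (σ ++ u)))
  (+-monoʳ-≤ (depth T []) (depth-++ (T ∘ (x ∷_)) σ u))

depth-mono : ∀ T → σ ⪯ ρ → depth T σ ≤ depth T ρ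
depth-mono {σ} T (u , refl) = depth-++ T σ u

take-take-≤ : ∀ {A : Set} → m ≤ n → (xs : List A) → take m (take n xs) ≡ take m xs
take-take-≤ {m} {n} m≤n xs = trans (take-take m n xs) (cong (λ i → take i xs) (m≤n⇒m⊓n≡m m≤n))

Restrict-length : {A : SubsetK k} → Restrict n A ζ → length ζ ≤ n
Restrict-length {n = n} (η , _ , refl) = subst (_≤ n) (sym (length-take n η)) (m⊓n≤m n _)

Restrict-restrict : {A : SubsetK k} → m ≤ n → Restrict n A η → take m η ≡ ζ → Restrict m A ζ
Restrict-restrict m≤n (θ , θ∈A , refl) refl = θ , θ∈A , sym (take-take-≤ m≤n θ)

lists≤ : (k n : ℕ) → List (List (Fin k))
lists≤ k zero = [ [] ]
lists≤ k (suc n) = [] ∷ cartesianProductWith _∷_ (allFin k) (lists≤ k n)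

∈-lists≤ : (ζ : List (Fin k)) → length ζ ≤ n → ζ ∈ lists≤ k n
∈-lists≤ {n = zero} [] _ = here refl
∈-lists≤ {n = suc n} [] _ = here refl
∈-lists≤ {n = suc n} (i ∷ ζ) (s≤s ζ≤n) =
  there (∈-cartesianProductWith⁺ _∷_ (∈-allFin i) (∈-lists≤ ζ ζ≤n))

module _ (T : Tree) where

  DenseAbove : Str → (Str → Set) → Set
  DenseAbove ρ₀ Q = ∀ σ → σ ∈T T → ρ₀ ⪯ σ → ∃[ σ' ] ((σ' ∈T T) × (σ ⪯ σ') × Q σ')

  UpwardClosedAbove : Str → (Str → Set) → Set
  UpwardClosedAbove ρ₀ Q = ∀ {σ σ'} → σ ∈T T → ρ₀ ⪯ σ → σ' ∈T T → σ ⪯ σ' → Q σ → Q σ'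

  denseAbove-All : ∀ {A : Set} {ρ₀} (Q : A → Str → Set) →
    (∀ a → UpwardClosedAbove ρ₀ (Q a)) → (∀ a → DenseAbove ρ₀ (Q a)) →
    ∀ as → DenseAbove ρ₀ (λ σ → All (λ a → Q a σ) as)
  denseAbove-All Q upward dense [] σ σT _ = σ , σT , ⪯-refl , []
  denseAbove-All Q upward dense (a ∷ as) σ σT ρ₀⪯σ =
    let (σ₁ , σ₁T , σ⪯σ₁ , Qs) = denseAbove-All Q upward dense as σ σT ρ₀⪯σ
        ρ₀⪯σ₁ = ⪯-trans ρ₀⪯σ σ⪯σ₁
        (σ₂ , σ₂T , σ₁⪯σ₂ , Qa) = dense a σ₁ σ₁T ρ₀⪯σ₁
    in σ₂ , σ₂T , ⪯-trans σ⪯σ₁ σ₁⪯σ₂ ,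
       Qa ∷ All.map (λ {b} → upward b σ₁T ρ₀⪯σ₁ σ₂T σ₁⪯σ₂) Qs

  strict-extension : NoLeaves T → ρ ∈T T → ρ ⪯ ρ' → ρ' ∈T T →
    ∃[ ρ₁ ] ((ρ₁ ∈T T) × (ρ ≺ ρ₁) × (ρ' ⪯ ρ₁))
  strict-extension {ρ} {ρ'} noLeaves ρT ρ⪯ρ' ρ'T with ≡-dec _≟_ ρ ρ'
  ... | yes refl = let (ρ₁ , ρ₁T , ρ≺ρ₁) = noLeaves ρ ρT in ρ₁ , ρ₁T , ρ≺ρ₁ , proj₁ ρ≺ρ₁
  ... | no ρ≢ρ' = ρ' , ρ'T , (ρ⪯ρ' , ρ≢ρ') , ⪯-refl

module Classical (dne : DoubleNegationElimination 0ℓ) (T : Tree) where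

  immSucc-below : σ ≺ τ → τ ∈T T → ∃[ ρ⁺ ] (ImmSucc T σ ρ⁺ × ρ⁺ ⪯ τ)
  immSucc-below {τ = τ} = go (<-wellFounded (length τ))
    where
    -- τ itself is an immediate successor unless some σ' lies strictly in between.
    go : ∀ {σ τ} → Acc _<_ (length τ) → σ ≺ τ → τ ∈T T → ∃[ ρ⁺ ] (ImmSucc T σ ρ⁺ × ρ⁺ ⪯ τ)
    go {σ} {τ} (acc shorter) σ≺τ τT = dne λ none →
      none (τ , (τT , σ≺τ , λ σ' σ'T σ≺σ' σ'≺τ →
        let (ρ⁺ , imm , ρ⁺⪯σ') = go (shorter (≺⇒length< σ'≺τ)) σ≺σ' σ'T
        in none (ρ⁺ , imm , ⪯-trans ρ⁺⪯σ' (proj₁ σ'≺τ))) , ⪯-refl)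

  module Refinement {f : Str → SubsetK k} (split : IsTreeSplit k T f) where

    ∣_∣ : Str → ℕ
    ∣ ρ ∣ = depth T ρ

    ∈-immSucc⇒∈ : σ ∈T T → ImmSucc T σ ρ⁺ → f ρ⁺ θ → f σ (take ∣ σ ∣ θ)
    ∈-immSucc⇒∈ {σ} {ρ⁺} {θ} σT imm θ∈ =
      Equivalence.from (proj₂ (proj₂ (split σ σT)) (take ∣ σ ∣ θ)) (ρ⁺ , imm , θ , θ∈ , refl)

    descend : σ ∈T T → σ' ∈T T → σ ⪯ σ' → f σ' θ → f σ (take ∣ σ ∣ θ)
    descend {σ} {σ'} = go (<-wellFounded (length σ' ∸ length σ))
      where
      go : ∀ {σ σ' θ} → Acc _<_ (length σ' ∸ length σ) →
        σ ∈T T → σ' ∈T T → σ ⪯ σ' → f σ' θ → f σ (take ∣ σ ∣ θ)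
      go {σ} {σ'} {θ} (acc closer) σT σ'T σ⪯σ' θ∈ with ≡-dec _≟_ σ σ'
      ... | yes refl =
        subst (f σ) (sym (take-all ∣ σ ∣ θ (≤-reflexive (proj₁ (split σ σT) θ θ∈)))) θ∈
      ... | no σ≢σ' =
        let (ρ⁺ , imm , ρ⁺⪯σ') = immSucc-below (σ⪯σ' , σ≢σ') σ'T
            σ≺ρ⁺ = proj₁ (proj₂ imm)
            θ↾∈ = go (closer (∸-monoʳ-< (≺⇒length< σ≺ρ⁺) (⪯⇒length≤ ρ⁺⪯σ'))) (proj₁ imm) σ'T ρ⁺⪯σ' θ∈
        in subst (f σ) (take-take-≤ (depth-mono T (proj₁ σ≺ρ⁺)) θ) (∈-immSucc⇒∈ σT imm θ↾∈)

    Restrict-descend : n ≤ ∣ σ ∣ → σ ∈T T → σ' ∈T T → σ ⪯ σ' →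
      Restrict n (f σ') ζ → Restrict n (f σ) ζ
    Restrict-descend {σ = σ} n≤∣σ∣ σT σ'T σ⪯σ' (θ , θ∈ , θ↾≡ζ) =
      take ∣ σ ∣ θ , descend σT σ'T σ⪯σ' θ∈ , trans (take-take-≤ n≤∣σ∣ θ) θ↾≡ζ

    StableFrom : ℕ → Str → List (Fin k) → Set
    StableFrom n ρ' ζ = ∀ ρ'' → ρ'' ∈T T → ρ' ⪯ ρ'' → Restrict n (f ρ'') ζ

    Persists : Str → SubsetK k
    Persists ρ ζ = ∃[ ρ' ] ((ρ' ∈T T) × (ρ ⪯ ρ') × StableFrom ∣ ρ ∣ ρ' ζ)

    persists⇒∈ : ρ ∈T T → Persists ρ ζ → f ρ ζ
    persists⇒∈ {ρ} ρT (ρ' , ρ'T , ρ⪯ρ' , stable) =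
      let (θ , θ∈ , θ↾≡ζ) = stable ρ' ρ'T ⪯-refl in subst (f ρ) θ↾≡ζ (descend ρT ρ'T ρ⪯ρ' θ∈)

    persisting-witness : ∀ {ρ ρ₀} (P : List (Fin k) → Set) → ρ ⪯ ρ₀ → ρ₀ ∈T T →
      (∀ σ → σ ∈T T → ρ₀ ⪯ σ → ∃[ η ] (P η × Restrict ∣ ρ ∣ (f σ) η)) →
      ∃[ η ] (P η × Persists ρ η)
    persisting-witness {ρ} {ρ₀} P ρ⪯ρ₀ ρ₀T everywhere = dne λ none →
      let (σ , σT , ρ₀⪯σ , allAbsent) =
            denseAbove-All T Absent upward (dense none) (lists≤ _ ∣ ρ ∣) ρ₀ ρ₀T ⪯-refl
          (η , Pη , η∈) = everywhere σ σT ρ₀⪯σ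
      in All.lookup allAbsent (∈-lists≤ η (Restrict-length η∈)) Pη η∈
      where
      Absent : List (Fin _) → Str → Set
      Absent η σ = P η → ¬ Restrict ∣ ρ ∣ (f σ) η

      upward : ∀ η → UpwardClosedAbove T ρ₀ (Absent η)
      upward η σT ρ₀⪯σ σ'T σ⪯σ' absent Pη present =
        absent Pη (Restrict-descend (depth-mono T (⪯-trans ρ⪯ρ₀ ρ₀⪯σ)) σT σ'T σ⪯σ' present)

      dense : ¬ (∃[ η ] (P η × Persists ρ η)) → ∀ η → DenseAbove T ρ₀ (Absent η)
      dense none η σ σT ρ₀⪯σ = dne λ neverAbsent →
        none (η , dne (λ ¬Pη → neverAbsent (σ , σT , ⪯-refl , λ Pη → ⊥-elim (¬Pη Pη))) ,
              σ , σT , ⪯-trans ρ⪯ρ₀ ρ₀⪯σ ,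
              λ σ' σ'T σ⪯σ' → dne λ ¬present → neverAbsent (σ' , σ'T , σ⪯σ' , λ _ → ¬present))

    persists-lift : ∀ {ρ₀} → ρ ⪯ ρ⁺ → ρ⁺ ⪯ ρ₀ → ρ' ⪯ ρ₀ → ρ₀ ∈T T →
      StableFrom ∣ ρ ∣ ρ' ζ → Restrict ∣ ρ ∣ (Persists ρ⁺) ζ
    persists-lift {ρ} {ρ⁺} {ζ = ζ} {ρ₀} ρ⪯ρ⁺ ρ⁺⪯ρ₀ ρ'⪯ρ₀ ρ₀T stable =
      let (η , η↾≡ζ , η-persists) = persisting-witness (λ η → take ∣ ρ ∣ η ≡ ζ) ρ⁺⪯ρ₀ ρ₀T candidate
      in η , η-persists , η↾≡ζ
      where
      candidate : ∀ σ → σ ∈T T → ρ₀ ⪯ σ → ∃[ η ] ((take ∣ ρ ∣ η ≡ ζ) × Restrict ∣ ρ⁺ ∣ (f σ) η)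
      candidate σ σT ρ₀⪯σ =
        let (θ , θ∈ , θ↾≡ζ) = stable σ σT (⪯-trans ρ'⪯ρ₀ ρ₀⪯σ)
        in take ∣ ρ⁺ ∣ θ , trans (take-take-≤ (depth-mono T ρ⪯ρ⁺) θ) θ↾≡ζ , θ , θ∈ , refl

    persists-isTreeSplit : NoLeaves T → IsTreeSplit k T Persists
    persists-isTreeSplit noLeaves ρ ρT =
      (λ ζ → proj₁ (split ρ ρT) ζ ∘ persists⇒∈ ρT) , nonempty , λ ζ → mk⇔ toSucc fromSucc
      where
      nonempty : ∃[ ζ ] Persists ρ ζ
      nonempty =
        let (ζ , _ , ζ-persists) = persisting-witness (λ _ → ⊤) ⪯-refl ρT λ σ σT _ →
              let (θ , θ∈) = proj₁ (proj₂ (split σ σT)) in take ∣ ρ ∣ θ , tt , θ , θ∈ , refl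
        in ζ , ζ-persists

      toSucc : Persists ρ ζ → ∃[ ρ⁺ ] (ImmSucc T ρ ρ⁺ × Restrict ∣ ρ ∣ (Persists ρ⁺) ζ)
      toSucc (ρ' , ρ'T , ρ⪯ρ' , stable) =
        let (ρ₁ , ρ₁T , ρ≺ρ₁ , ρ'⪯ρ₁) = strict-extension T noLeaves ρT ρ⪯ρ' ρ'T
            (ρ⁺ , imm , ρ⁺⪯ρ₁) = immSucc-below ρ≺ρ₁ ρ₁T
        in ρ⁺ , imm , persists-lift (proj₁ (proj₁ (proj₂ imm))) ρ⁺⪯ρ₁ ρ'⪯ρ₁ ρ₁T stable

      fromSucc : ∃[ ρ⁺ ] (ImmSucc T ρ ρ⁺ × Restrict ∣ ρ ∣ (Persists ρ⁺) ζ) → Persists ρ ζ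
      fromSucc (ρ⁺ , (_ , (ρ⪯ρ⁺ , _) , _) , η , (ρ' , ρ'T , ρ⁺⪯ρ' , stable) , η↾≡ζ) =
        ρ' , ρ'T , ⪯-trans ρ⪯ρ⁺ ρ⁺⪯ρ' , λ ρ'' ρ''T ρ'⪯ρ'' →
          Restrict-restrict (depth-mono T ρ⪯ρ⁺) (stable ρ'' ρ''T ρ'⪯ρ'') η↾≡ζ

    persists-refined : Refined k T Persists
    persists-refined ρ _ ζ (ρ' , ρ'T , ρ⪯ρ' , stable) = ρ' , ρ'T , ρ⪯ρ' , λ ρ'' ρ''T ρ'⪯ρ'' →
      persists-lift (⪯-trans ρ⪯ρ' ρ'⪯ρ'') ⪯-refl ρ'⪯ρ'' ρ''T stable

lemma3p16 : ExcludedMiddle 0ℓ →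
    (k : ℕ) → 1 ≤ k → (T : Tree) → NonemptyTree T → NoLeaves T →
    (f : Str → SubsetK k) → IsTreeSplit k T f →
    ∃[ f̃ ] (IsTreeSplit k T f̃ × Refined k T f̃ ×
      (∀ ρ → ρ ∈T T → ∀ ζ → f̃ ρ ζ → f ρ ζ))
lemma3p16 em k _ T _ noLeaves f split =
  Persists , persists-isTreeSplit noLeaves , persists-refined , λ ρ ρT ζ → persists⇒∈ ρT
  where
  open Classical (em⇒dne em) T
  open Refinement split
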